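{- Let $(a,b)$ be a $7$-groomed pair. Then \[ \mathrm{tmd}(A_7(a,b),B_7(a,b))\le \frac{3^{5/4}\cdot7^{9/2}}{2^{1/6}}\,\mathrm{twht}(A_7(a,b),B_7(a,b))^{1/12}. \]
   Context: $A_7(a,b)=-3(a^2+ab+7b^2)(a^2-231ab+735b^2)$ and $B_7(a,b)=2(a^2+ab+7b^2)(a^4+518a^3b-11025a^2b^2+6174ab^3-64827b^4)$. A pair $(a,b)\in\mathbb{Z}^2$ is $7$-groomed if $\gcd(a,b)=1$, $b>0$ and $a/b\ne-7$. $H(A,B)=\max(|4A^3|,|27B^2|)$; for integers $A,B$ not both zero, $\mathrm{tmd}(A,B)$ is the largest positive integer $e$ with $e^2\mid A$ and $e^3\mid B$, and $\mathrm{twht}(A,B)=H(A,B)/\mathrm{tmd}(A,B)^6$. -}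

module Defs where

open import Data.Nat as ℕ using (ℕ; NonZero; _⊔_)
open import Data.Nat.Properties using (m^n≢0)
open import Data.Integer as ℤ using (ℤ; +_; -_; _+_; _-_; _*_; _^_; ∣_∣)
open import Data.Integer.Divisibility using (_∣_)
open import Data.Integer.GCD using (gcd)
open import Data.Rational as ℚ using (ℚ; _/_)
open import Data.Product using (_×_)
open import Relation.Binary.PropositionalEquality using (_≡_; _≢_)

A7 : ℤ → ℤ → ℤ
A7 a b = - (+ 3) * (a ^ 2 + a * b + + 7 * b ^ 2)
               * (a ^ 2 - + 231 * a * b + + 735 * b ^ 2)

B7 : ℤ → ℤ → ℤ
B7 a b = + 2 * (a ^ 2 + a * b + + 7 * b ^ 2)
             * (a ^ 4 + + 518 * a ^ 3 * b - + 11025 * a ^ 2 * b ^ 2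
                + + 6174 * a * b ^ 3 - + 64827 * b ^ 4)

-- (a,b) is 7-groomed: gcd(a,b)=1, b>0, a/b ≠ -7 (i.e. a ≠ -7b, as b > 0)
Groomed7 : ℤ → ℤ → Set
Groomed7 a b = (gcd a b ≡ + 1) × (ℤ.+0 ℤ.< b) × (a ≢ - (+ 7) * b)

H : ℤ → ℤ → ℕ
H A B = ∣ + 4 * A ^ 3 ∣ ⊔ ∣ + 27 * B ^ 2 ∣

IsTmdCandidate : ℤ → ℤ → ℕ → Set
IsTmdCandidate A B e = (0 ℕ.< e) × ((+ e) ^ 2 ∣ A) × ((+ e) ^ 3 ∣ B)

IsTmd : ℤ → ℤ → ℕ → Set
IsTmd A B e = IsTmdCandidate A B e × (∀ f → IsTmdCandidate A B f → f ℕ.≤ e)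

-- twht(A,B) = H(A,B) / tmd(A,B)^6, given e = tmd(A,B) (nonzero)
twht : (A B : ℤ) (e : ℕ) → .{{NonZero e}} → ℚ
twht A B e = _/_ (+ H A B) (e ℕ.^ 6) {{m^n≢0 e 6}}

-- Write U = a² + ab + 7b², so that A₇ = −3·U·Q₂ and B₇ = 2·U·Q₄ for the remaining factors Q₂, Q₄.
-- If e² ∣ A₇ and e³ ∣ B₇ then e⁶ divides every integer combination of A₇³ and B₇².  Explicit
-- polynomial identities exhibit X¹⁵·M and 7ʲ·Y¹⁵·M as such combinations, where M = 2⁸3⁶7¹⁴·U² and
-- X, Y are coprime with 7 ∤ X: (X, Y) is (a, b), or (s, b) when a = 7s − 7b, or (b, c) when
-- a = 49c − 7b, according to how often 7 divides a.  Hence e⁶ ∣ M.  On the other hand, cutting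
-- b > 0 along a/b = 3, 4, 53 gives |Q₂| ≥ U or |Q₄| ≥ U² everywhere, so H(A₇, B₇) ≥ 108·U⁶.
-- Therefore 4e¹⁸ ≤ 4·(2⁸3⁶7¹⁴)³·U⁶ ≤ 3¹⁵7⁵⁴·108·U⁶ ≤ 3¹⁵7⁵⁴·H(A₇, B₇), which is the claim.

module Submission where

open import Defs

module _ where

  open import Data.Bool.Base using (T)
  open import Data.Fin.Base using (Fin; zero; suc)
  open import Data.Integer.Base
    using (ℤ; +_; -[1+_]; 0ℤ; _+_; _-_; _*_; _^_; -_; ∣_∣; _≤_; _<_; +≤+; +<+; nonNegative; >-nonZero)
  import Data.Integer.Properties as ℤₚ
  open import Data.Integer.Coprimality using (Coprime)
  open import Data.Integer.Divisibility using (_∣_)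
  import Data.Integer.Divisibility.Signed as Signed
  open import Data.Integer.GCD using (gcd)
  import Data.Integer.Solver
  open import Data.List.Base using (List; []; _∷_; length; map)
  open import Data.Maybe using (is-just; to-witness-T)
  import Data.Nat.Base as ℕ
  open ℕ using (ℕ; zero; suc; z≤n; s≤s)
  import Data.Nat.Coprimality as ℕ
  import Data.Nat.Divisibility as ℕ
  open import Data.Nat.Primality using (Prime; prime?; prime⇒irreducible)
  import Data.Nat.Properties as ℕₚ
  import Data.Nat.Solver
  open import Data.Product.Base using (∃₂; _×_; _,_)
  import Data.Rational.Base as ℚ
  import Data.Rational.Properties as ℚₚ
  import Data.Rational.Unnormalised.Base as ℚᵘ
  import Data.Rational.Unnormalised.Properties as ℚᵘₚ
  open import Data.Sum.Base using (_⊎_; inj₁; inj₂)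
  open import Data.Vec.Base using (Vec; []; _∷_; lookup)
  open import Relation.Binary.PropositionalEquality
  open import Relation.Nullary using (¬_; Dec; yes; no; contradiction)
  open import Relation.Nullary.Decidable using (from-yes)

  module ℤSolver = Data.Integer.Solver.+-*-Solver
  module ℕSolver = Data.Nat.Solver.+-*-Solver

  -- Polynomial identities over ℤ

  infixl 6 _⊕_ _⊖_
  infixl 7 _⊗_
  infix  8 ⊝_
  infixr 8 _⊛_

  data Expr (n : ℕ) : Set where
    var         : Fin n → Expr n
    con         : ℤ → Expr n
    _⊕_ _⊖_ _⊗_ : Expr n → Expr n → Expr n
    ⊝_          : Expr n → Expr n
    _⊛_         : Expr n → ℕ → Expr n

  -- Opaque: otherwise, comparing two evaluated expressions makes the typechecker unfold the
  -- integer arithmetic inside them, at a cost exponential in their depth.  For the same reason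
  -- implicit arguments that would be solved by unifying large integer terms are given explicitly.
  opaque
    ⟦_⟧ : ∀ {n} → Expr n → Vec ℤ n → ℤ
    ⟦ var i ⟧ ρ = lookup ρ i
    ⟦ con c ⟧ ρ = c
    ⟦ e ⊕ f ⟧ ρ = ⟦ e ⟧ ρ + ⟦ f ⟧ ρ
    ⟦ e ⊖ f ⟧ ρ = ⟦ e ⟧ ρ - ⟦ f ⟧ ρ
    ⟦ e ⊗ f ⟧ ρ = ⟦ e ⟧ ρ * ⟦ f ⟧ ρ
    ⟦ ⊝ e   ⟧ ρ = - ⟦ e ⟧ ρ
    ⟦ e ⊛ k ⟧ ρ = ⟦ e ⟧ ρ ^ k

  module _ {n} (ρ : Vec ℤ n) where
    opaque
      unfolding ⟦_⟧

      ⟦var⟧ : ∀ i → ⟦ var i ⟧ ρ ≡ lookup ρ i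
      ⟦var⟧ i = refl

      ⟦con⟧ : ∀ c → ⟦ con c ⟧ ρ ≡ c
      ⟦con⟧ c = refl

      ⟦⊕⟧ : ∀ e f → ⟦ e ⊕ f ⟧ ρ ≡ ⟦ e ⟧ ρ + ⟦ f ⟧ ρ
      ⟦⊕⟧ e f = refl

      ⟦⊖⟧ : ∀ e f → ⟦ e ⊖ f ⟧ ρ ≡ ⟦ e ⟧ ρ - ⟦ f ⟧ ρ
      ⟦⊖⟧ e f = refl

      ⟦⊗⟧ : ∀ e f → ⟦ e ⊗ f ⟧ ρ ≡ ⟦ e ⟧ ρ * ⟦ f ⟧ ρ
      ⟦⊗⟧ e f = refl

      ⟦⊝⟧ : ∀ e → ⟦ ⊝ e ⟧ ρ ≡ - ⟦ e ⟧ ρ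
      ⟦⊝⟧ e = refl

      ⟦⊛⟧ : ∀ e k → ⟦ e ⊛ k ⟧ ρ ≡ ⟦ e ⟧ ρ ^ k
      ⟦⊛⟧ e k = refl

  toPolynomial : ∀ {n} → Expr n → ℤSolver.Polynomial n
  toPolynomial (var i) = ℤSolver.var i
  toPolynomial (con c) = ℤSolver.con c
  toPolynomial (e ⊕ f) = toPolynomial e ℤSolver.:+ toPolynomial f
  toPolynomial (e ⊖ f) = toPolynomial e ℤSolver.:- toPolynomial f
  toPolynomial (e ⊗ f) = toPolynomial e ℤSolver.:* toPolynomial f
  toPolynomial (⊝ e)   = ℤSolver.:- toPolynomial e
  toPolynomial (e ⊛ k) = toPolynomial e ℤSolver.:^ k

  ⟦toPolynomial⟧ : ∀ {n} (e : Expr n) ρ → ℤSolver.⟦ toPolynomial e ⟧ ρ ≡ ⟦ e ⟧ ρ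
  ⟦toPolynomial⟧ (var i) ρ = sym (⟦var⟧ ρ i)
  ⟦toPolynomial⟧ (con c) ρ = sym (⟦con⟧ ρ c)
  ⟦toPolynomial⟧ (e ⊕ f) ρ = trans (cong₂ _+_ (⟦toPolynomial⟧ e ρ) (⟦toPolynomial⟧ f ρ)) (sym (⟦⊕⟧ ρ e f))
  ⟦toPolynomial⟧ (e ⊖ f) ρ = trans (cong₂ _-_ (⟦toPolynomial⟧ e ρ) (⟦toPolynomial⟧ f ρ)) (sym (⟦⊖⟧ ρ e f))
  ⟦toPolynomial⟧ (e ⊗ f) ρ = trans (cong₂ _*_ (⟦toPolynomial⟧ e ρ) (⟦toPolynomial⟧ f ρ)) (sym (⟦⊗⟧ ρ e f))
  ⟦toPolynomial⟧ (⊝ e)   ρ = trans (cong -_ (⟦toPolynomial⟧ e ρ)) (sym (⟦⊝⟧ ρ e))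
  ⟦toPolynomial⟧ (e ⊛ k) ρ = trans (power k) (trans (cong (_^ k) (⟦toPolynomial⟧ e ρ)) (sym (⟦⊛⟧ ρ e k)))
    where
    power : ∀ k → ℤSolver.⟦ toPolynomial e ℤSolver.:^ k ⟧ ρ ≡ ℤSolver.⟦ toPolynomial e ⟧ ρ ^ k
    power zero    = refl
    power (suc k) = cong (ℤSolver.⟦ toPolynomial e ⟧ ρ *_) (power k)

  -- The library's `solve` evaluates both normal forms at symbolic variables and compares the
  -- results, which is infeasible at degree 19; comparing the normal forms themselves is fast.
  SameNormalForm : ∀ {n} → Expr n → Expr n → Set
  SameNormalForm e f =
    T (is-just (ℤSolver.normalise (toPolynomial e) ℤSolver.≟N ℤSolver.normalise (toPolynomial f)))

  ≡-by-normalisation : ∀ {n} (e f : Expr n) → SameNormalForm e f → ∀ ρ → ⟦ e ⟧ ρ ≡ ⟦ f ⟧ ρ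
  ≡-by-normalisation e f e≈f ρ = begin
    ⟦ e ⟧ ρ                                            ≡⟨ ⟦toPolynomial⟧ e ρ ⟨
    ℤSolver.⟦ toPolynomial e ⟧ ρ                       ≡⟨ ℤSolver.correct (toPolynomial e) ρ ⟨
    ℤSolver.⟦ ℤSolver.normalise (toPolynomial e) ⟧N ρ  ≡⟨ ℤSolver.⟦ to-witness-T _ e≈f ⟧N-cong ρ ⟩
    ℤSolver.⟦ ℤSolver.normalise (toPolynomial f) ⟧N ρ  ≡⟨ ℤSolver.correct (toPolynomial f) ρ ⟩
    ℤSolver.⟦ toPolynomial f ⟧ ρ                       ≡⟨ ⟦toPolynomial⟧ f ρ ⟩
    ⟦ f ⟧ ρ                                            ∎
    where open ≡-Reasoning

  binaryForm : ∀ {n} → List ℤ → Expr n → Expr n → Expr n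
  binaryForm []       x y = con 0ℤ
  binaryForm (c ∷ cs) x y = con c ⊗ x ⊛ length cs ⊕ y ⊗ binaryForm cs x y

  *-nonNeg : ∀ {i j} → 0ℤ ≤ i → 0ℤ ≤ j → 0ℤ ≤ i * j
  *-nonNeg {+ m} {+ n} _ _ = subst (0ℤ ≤_) (ℤₚ.pos-* m n) (+≤+ z≤n)

  ^-nonNeg : ∀ {i} k → 0ℤ ≤ i → 0ℤ ≤ i ^ k
  ^-nonNeg zero    0≤i = +≤+ z≤n
  ^-nonNeg (suc k) 0≤i = *-nonNeg 0≤i (^-nonNeg k 0≤i)

  ^2-nonNeg : ∀ i → 0ℤ ≤ i ^ 2
  ^2-nonNeg (+ n)    = ^-nonNeg {+ n} 2 (+≤+ z≤n)
  ^2-nonNeg -[1+ n ] = +≤+ z≤n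

  opaque
    unfolding ⟦_⟧

    binaryForm-nonNeg : ∀ {n} (cs : List ℕ) (x y : Expr n) ρ → 0ℤ ≤ ⟦ x ⟧ ρ → 0ℤ ≤ ⟦ y ⟧ ρ →
                        0ℤ ≤ ⟦ binaryForm (map +_ cs) x y ⟧ ρ
    binaryForm-nonNeg []       x y ρ 0≤x 0≤y = ℤₚ.≤-refl
    binaryForm-nonNeg (c ∷ cs) x y ρ 0≤x 0≤y =
      ℤₚ.+-mono-≤ (*-nonNeg {+ c} (+≤+ z≤n) (^-nonNeg (length (map +_ cs)) 0≤x))
                  (*-nonNeg 0≤y (binaryForm-nonNeg cs x y ρ 0≤x 0≤y))

  ≤-by-nonNeg-gap : ∀ {n} (e f x y : Expr n) (cs : List ℕ) → SameNormalForm e (f ⊕ binaryForm (map +_ cs) x y) →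
                    ∀ ρ → 0ℤ ≤ ⟦ x ⟧ ρ → 0ℤ ≤ ⟦ y ⟧ ρ → ⟦ f ⟧ ρ ≤ ⟦ e ⟧ ρ
  ≤-by-nonNeg-gap e f x y cs e≈f+g ρ 0≤x 0≤y = begin
    ⟦ f ⟧ ρ             ≤⟨ ℤₚ.i≤i+j (⟦ f ⟧ ρ) (⟦ g ⟧ ρ) {{nonNegative (binaryForm-nonNeg cs x y ρ 0≤x 0≤y)}} ⟩
    ⟦ f ⟧ ρ + ⟦ g ⟧ ρ   ≡⟨ ⟦⊕⟧ ρ f g ⟨
    ⟦ f ⊕ g ⟧ ρ         ≡⟨ ≡-by-normalisation e (f ⊕ g) e≈f+g ρ ⟨
    ⟦ e ⟧ ρ             ∎
    where
    open ℤₚ.≤-Reasoning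
    g = binaryForm (map +_ cs) x y

  ∣i^n∣≡∣i∣^n : ∀ i n → ∣ i ^ n ∣ ≡ ∣ i ∣ ℕ.^ n
  ∣i^n∣≡∣i∣^n i zero    = refl
  ∣i^n∣≡∣i∣^n i (suc n) = trans (ℤₚ.abs-* i (i ^ n)) (cong (∣ i ∣ ℕ.*_) (∣i^n∣≡∣i∣^n i n))

  ∣+k*i^n∣≡k*∣i∣^n : ∀ k i n → ∣ + k * i ^ n ∣ ≡ k ℕ.* ∣ i ∣ ℕ.^ n
  ∣+k*i^n∣≡k*∣i∣^n k i n = trans (ℤₚ.abs-* (+ k) (i ^ n)) (cong (k ℕ.*_) (∣i^n∣≡∣i∣^n i n))

  ∣m∣n⇒∣i*m-j*n : ∀ {k m n} i j → k ∣ m → k ∣ n → k ∣ i * m - j * n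
  ∣m∣n⇒∣i*m-j*n {k} {m} {n} i j k∣m k∣n =
    Signed.∣⇒∣ᵤ {k} {i * m - j * n} (Signed.∣m∣n⇒∣m-n (Signed.∣n⇒∣m*n i (Signed.∣ᵤ⇒∣ {k} {m} k∣m))
                                                    (Signed.∣n⇒∣m*n j (Signed.∣ᵤ⇒∣ {k} {n} k∣n)))

  coprime-linear : ∀ {m n} i j → Coprime (i * m - j * n) n → Coprime m n
  coprime-linear i j c {d} (d∣m , d∣n) = c (∣m∣n⇒∣i*m-j*n {+ d} i j d∣m d∣n , d∣n)

  coprime-*ʳ : ∀ {m n o} → ℕ.Coprime m n → ℕ.Coprime m o → ℕ.Coprime m (n ℕ.* o)
  coprime-*ʳ c₁ c₂ (d∣m , d∣no) =
    c₂ (d∣m , ℕ.coprime-divisor (λ (e∣d , e∣n) → c₁ (ℕ.∣-trans e∣d d∣m , e∣n)) d∣no)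

  coprime-^ʳ : ∀ {m n} k → ℕ.Coprime m n → ℕ.Coprime m (n ℕ.^ k)
  coprime-^ʳ zero    c (_ , d∣1) = ℕ.∣1⇒≡1 d∣1
  coprime-^ʳ (suc k) c = coprime-*ʳ c (coprime-^ʳ k c)

  prime∤⇒coprime : ∀ {p n} → Prime p → ¬ (p ℕ.∣ n) → ℕ.Coprime n p
  prime∤⇒coprime p-prime p∤n (d∣n , d∣p) with prime⇒irreducible p-prime d∣p
  ... | inj₁ d≡1  = d≡1
  ... | inj₂ refl = contradiction d∣n p∤n

  coprime-factors : ∀ {i j k m} → Coprime i j → k ∣ i * m → k ∣ j * m → k ∣ m
  coprime-factors {i} {j} {k} {m} c k∣im k∣jm = ℕ.coprime-factors c
    (subst (∣ k ∣ ℕ.∣_) (ℤₚ.abs-* i m) k∣im , subst (∣ k ∣ ℕ.∣_) (ℤₚ.abs-* j m) k∣jm)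

  CubeSquareCombination : ℤ → ℤ → ℤ → Set
  CubeSquareCombination A B n = ∃₂ λ α β → n ≡ α * A ^ 3 + β * B ^ 2

  combination-divisible : ∀ {d A B n} → d ^ 2 ∣ A → d ^ 3 ∣ B → CubeSquareCombination A B n → d ^ 6 ∣ n
  combination-divisible {d} {A} {B} d²∣A d³∣B (α , β , refl)
    with Signed.∣ᵤ⇒∣ {d ^ 2} {A} d²∣A | Signed.∣ᵤ⇒∣ {d ^ 3} {B} d³∣B
  ... | Signed.divides k refl | Signed.divides l refl =
    Signed.∣⇒∣ᵤ (Signed.divides (α * k ^ 3 + β * l ^ 2) regroup)
    where
    regroup : α * (k * d ^ 2) ^ 3 + β * (l * d ^ 3) ^ 2 ≡ (α * k ^ 3 + β * l ^ 2) * d ^ 6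
    regroup = solve 5 (λ α β k l d → α :* (k :* d :^ 2) :^ 3 :+ β :* (l :* d :^ 3) :^ 2
                                   := (α :* k :^ 3 :+ β :* l :^ 2) :* d :^ 6) refl α β k l d
      where open ℤSolver using (solve; _:=_; _:+_; _:*_; _:^_)

  cofactor-divisible : ∀ {d A B X Y M p} k j → Prime p → Coprime X Y → ¬ (+ p ∣ X) →
    CubeSquareCombination A B (X ^ k * M) → CubeSquareCombination A B ((+ p) ^ j * Y ^ k * M) →
    d ^ 2 ∣ A → d ^ 3 ∣ B → d ^ 6 ∣ M
  cofactor-divisible {d} {A} {B} {X} {Y} {M} {p} k j p-prime X⊥Y p∤X X-comb Y-comb d²∣A d³∣B =
    coprime-factors {X ^ k} {(+ p) ^ j * Y ^ k} {d ^ 6} {M} coprime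
      (combination-divisible {d} {A} {B} d²∣A d³∣B X-comb)
      (combination-divisible {d} {A} {B} d²∣A d³∣B Y-comb)
    where
    coprime : Coprime (X ^ k) ((+ p) ^ j * Y ^ k)
    coprime rewrite ∣i^n∣≡∣i∣^n X k | ℤₚ.abs-* ((+ p) ^ j) (Y ^ k) | ∣i^n∣≡∣i∣^n (+ p) j | ∣i^n∣≡∣i∣^n Y k =
      ℕ.sym (coprime-^ʳ k (ℕ.sym (coprime-*ʳ (coprime-^ʳ j (prime∤⇒coprime p-prime p∤X)) (coprime-^ʳ k X⊥Y))))

  prime[7] : Prime 7
  prime[7] = from-yes (prime? 7)

  0≤i≤j⇒∣i∣≤∣j∣ : ∀ {i j} → 0ℤ ≤ i → i ≤ j → ∣ i ∣ ℕ.≤ ∣ j ∣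
  0≤i≤j⇒∣i∣≤∣j∣ (+≤+ _) (+≤+ m≤n) = m≤n

  u≤q⇒108u⁶≤4[3uq]³ : ∀ {u q} → u ℕ.≤ q → 108 ℕ.* u ℕ.^ 6 ℕ.≤ 4 ℕ.* (3 ℕ.* u ℕ.* q) ℕ.^ 3
  u≤q⇒108u⁶≤4[3uq]³ {u} {q} u≤q = begin
    108 ℕ.* u ℕ.^ 6              ≡⟨ solve 1 (λ u → con 108 :* u :^ 6 := con 4 :* (con 3 :* u :* u) :^ 3) refl u ⟩
    4 ℕ.* (3 ℕ.* u ℕ.* u) ℕ.^ 3  ≤⟨ ℕₚ.*-monoʳ-≤ 4 (ℕₚ.^-monoˡ-≤ 3 (ℕₚ.*-monoʳ-≤ (3 ℕ.* u) u≤q)) ⟩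
    4 ℕ.* (3 ℕ.* u ℕ.* q) ℕ.^ 3  ∎
    where
    open ℕₚ.≤-Reasoning
    open ℕSolver using (solve; _:=_; _:*_; _:^_; con)

  u²≤q⇒108u⁶≤27[2uq]² : ∀ {u q} → u ℕ.* u ℕ.≤ q → 108 ℕ.* u ℕ.^ 6 ℕ.≤ 27 ℕ.* (2 ℕ.* u ℕ.* q) ℕ.^ 2
  u²≤q⇒108u⁶≤27[2uq]² {u} {q} u²≤q = begin
    108 ℕ.* u ℕ.^ 6                       ≡⟨ solve 1 (λ u → con 108 :* u :^ 6
                                                          := con 27 :* (con 2 :* u :* (u :* u)) :^ 2) refl u ⟩
    27 ℕ.* (2 ℕ.* u ℕ.* (u ℕ.* u)) ℕ.^ 2  ≤⟨ ℕₚ.*-monoʳ-≤ 27 (ℕₚ.^-monoˡ-≤ 2 (ℕₚ.*-monoʳ-≤ (2 ℕ.* u) u²≤q)) ⟩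
    27 ℕ.* (2 ℕ.* u ℕ.* q) ℕ.^ 2          ∎
    where
    open ℕₚ.≤-Reasoning
    open ℕSolver using (solve; _:=_; _:*_; _:^_; con)

  x≤u²k⇒4x³≤ch : ∀ {x u k c h} → x ℕ.≤ u ℕ.* u ℕ.* k → 4 ℕ.* k ℕ.^ 3 ℕ.≤ c ℕ.* 108 →
                 108 ℕ.* u ℕ.^ 6 ℕ.≤ h → 4 ℕ.* x ℕ.^ 3 ℕ.≤ c ℕ.* h
  x≤u²k⇒4x³≤ch {x} {u} {k} {c} {h} x≤u²k 4k³≤108c 108u⁶≤h = begin
    4 ℕ.* x ℕ.^ 3                ≤⟨ ℕₚ.*-monoʳ-≤ 4 (ℕₚ.^-monoˡ-≤ 3 x≤u²k) ⟩
    4 ℕ.* (u ℕ.* u ℕ.* k) ℕ.^ 3  ≡⟨ solve 2 (λ u k → con 4 :* (u :* u :* k) :^ 3 := con 4 :* k :^ 3 :* u :^ 6) refl u k ⟩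
    4 ℕ.* k ℕ.^ 3 ℕ.* u ℕ.^ 6    ≤⟨ ℕₚ.*-monoˡ-≤ (u ℕ.^ 6) 4k³≤108c ⟩
    c ℕ.* 108 ℕ.* u ℕ.^ 6        ≡⟨ ℕₚ.*-assoc c 108 (u ℕ.^ 6) ⟩
    c ℕ.* (108 ℕ.* u ℕ.^ 6)      ≤⟨ ℕₚ.*-monoʳ-≤ c 108u⁶≤h ⟩
    c ℕ.* h                      ∎
    where
    open ℕₚ.≤-Reasoning
    open ℕSolver using (solve; _:=_; _:*_; _:^_; con)

  e¹²*4e⁶≡4[e⁶]³ : ∀ e → e ℕ.^ 12 ℕ.* (4 ℕ.* e ℕ.^ 6) ≡ 4 ℕ.* (e ℕ.^ 6) ℕ.^ 3
  e¹²*4e⁶≡4[e⁶]³ = solve 1 (λ e → e :^ 12 :* (con 4 :* e :^ 6) := con 4 :* (e :^ 6) :^ 3) refl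
    where open ℕSolver using (solve; _:=_; _:*_; _:^_; con)

  n*[d*m]≤c*h⇒n/1≤c/d*h/m : ∀ {n c h d m} .{{_ : ℕ.NonZero d}} .{{_ : ℕ.NonZero m}} →
    n ℕ.* (d ℕ.* m) ℕ.≤ c ℕ.* h → (+ n) ℚ./ 1 ℚ.≤ ((+ c) ℚ./ d) ℚ.* ((+ h) ℚ./ m)
  n*[d*m]≤c*h⇒n/1≤c/d*h/m {n} {c} {h} {suc d} {suc m} le = ℚₚ.toℚᵘ-cancel-≤
    (ℚᵘₚ.≤-respˡ-≃ (ℚᵘₚ.≃-sym (ℚₚ.toℚᵘ-fromℚᵘ (ℚᵘ.mkℚᵘ (+ n) 0)))
    (ℚᵘₚ.≤-respʳ-≃ (ℚᵘₚ.≃-sym product) (ℚᵘ.*≤* (subst₂ _≤_ (ℤₚ.pos-* n _) c*h≡c*h*1 (+≤+ le)))))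
    where
    product : ℚ.toℚᵘ (((+ c) ℚ./ suc d) ℚ.* ((+ h) ℚ./ suc m)) ℚᵘ.≃ ℚᵘ.mkℚᵘ (+ c) d ℚᵘ.* ℚᵘ.mkℚᵘ (+ h) m
    product = ℚᵘₚ.≃-trans (ℚₚ.toℚᵘ-homo-* ((+ c) ℚ./ suc d) ((+ h) ℚ./ suc m))
                (ℚᵘₚ.*-cong (ℚₚ.toℚᵘ-fromℚᵘ (ℚᵘ.mkℚᵘ (+ c) d)) (ℚₚ.toℚᵘ-fromℚᵘ (ℚᵘ.mkℚᵘ (+ h) m)))
    c*h≡c*h*1 : + (c ℕ.* h) ≡ + c * + h * + 1
    c*h≡c*h*1 = trans (ℤₚ.pos-* c h) (sym (ℤₚ.*-identityʳ (+ c * + h)))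

  -- The factors of A₇ and B₇

  U Q₂ Q₄ : ℤ → ℤ → ℤ
  U  a b = a ^ 2 + a * b + + 7 * b ^ 2
  Q₂ a b = a ^ 2 - + 231 * a * b + + 735 * b ^ 2
  Q₄ a b = a ^ 4 + + 518 * a ^ 3 * b - + 11025 * a ^ 2 * b ^ 2 + + 6174 * a * b ^ 3 - + 64827 * b ^ 4

  A7≡-3UQ₂ : ∀ a b → A7 a b ≡ - + 3 * U a b * Q₂ a b
  A7≡-3UQ₂ a b = refl

  B7≡2UQ₄ : ∀ a b → B7 a b ≡ + 2 * U a b * Q₄ a b
  B7≡2UQ₄ a b = refl

  4U≡[2a+b]²+27b² : ∀ a b → + 4 * U a b ≡ (+ 2 * a + b) ^ 2 + + 27 * b ^ 2
  4U≡[2a+b]²+27b² = solve 2 (λ a b → con (+ 4) :* (a :^ 2 :+ a :* b :+ con (+ 7) :* b :^ 2)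
                                    := (con (+ 2) :* a :+ b) :^ 2 :+ con (+ 27) :* b :^ 2) refl
    where open ℤSolver using (solve; _:=_; _:+_; _:*_; _:^_; con)

  0<U : ∀ a {b} → 0ℤ < b → 0ℤ < U a b
  0<U a {+ zero}  (+<+ ())
  0<U a {+ suc k} _ = ℤₚ.*-cancelˡ-<-nonNeg {0ℤ} {U a b} (+ 4)
    (subst (0ℤ <_) (sym (4U≡[2a+b]²+27b² a b)) (ℤₚ.+-mono-≤-< (^2-nonNeg (+ 2 * a + b)) (+<+ (s≤s z≤n))))
    where b = + suc k

  κ : ℕ
  κ = 2 ℕ.^ 8 ℕ.* 3 ℕ.^ 6 ℕ.* 7 ℕ.^ 14

  -- κ stands on the right: ℕ multiplication recurses on its left argument, and a huge literal
  -- there would be unfolded one by one whenever the typechecker compares two such products.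
  M : ℤ → ℤ → ℤ
  M a b = U a b * U a b * + κ

  Uₑ Q₂ₑ Q₄ₑ A7ₑ B7ₑ Mₑ : ∀ {n} → Expr n → Expr n → Expr n
  Uₑ  x y = x ⊛ 2 ⊕ x ⊗ y ⊕ con (+ 7) ⊗ y ⊛ 2
  Q₂ₑ x y = x ⊛ 2 ⊖ con (+ 231) ⊗ x ⊗ y ⊕ con (+ 735) ⊗ y ⊛ 2
  Q₄ₑ x y = x ⊛ 4 ⊕ con (+ 518) ⊗ x ⊛ 3 ⊗ y ⊖ con (+ 11025) ⊗ x ⊛ 2 ⊗ y ⊛ 2
            ⊕ con (+ 6174) ⊗ x ⊗ y ⊛ 3 ⊖ con (+ 64827) ⊗ y ⊛ 4
  A7ₑ x y = con (- + 3) ⊗ Uₑ x y ⊗ Q₂ₑ x y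
  B7ₑ x y = con (+ 2) ⊗ Uₑ x y ⊗ Q₄ₑ x y
  Mₑ  x y = Uₑ x y ⊗ Uₑ x y ⊗ con (+ κ)

  module _ {n} (x y : Expr n) (ρ : Vec ℤ n) where
    opaque
      unfolding ⟦_⟧

      ⟦A7ₑ⟧ : ⟦ A7ₑ x y ⟧ ρ ≡ A7 (⟦ x ⟧ ρ) (⟦ y ⟧ ρ)
      ⟦A7ₑ⟧ = refl

      ⟦B7ₑ⟧ : ⟦ B7ₑ x y ⟧ ρ ≡ B7 (⟦ x ⟧ ρ) (⟦ y ⟧ ρ)
      ⟦B7ₑ⟧ = refl

      ⟦Mₑ⟧ : ⟦ Mₑ x y ⟧ ρ ≡ M (⟦ x ⟧ ρ) (⟦ y ⟧ ρ)
      ⟦Mₑ⟧ = refl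

  v₀ v₁ : Expr 2
  v₀ = var zero
  v₁ = var (suc zero)

  -- e⁶ divides M

  certified-combination : ∀ (â ẑ : Expr 2) ((α , β) : List ℤ × List ℤ) →
    SameNormalForm (ẑ ⊗ Mₑ â v₀) (binaryForm α v₀ v₁ ⊗ A7ₑ â v₀ ⊛ 3 ⊕ binaryForm β v₀ v₁ ⊗ B7ₑ â v₀ ⊛ 2) →
    ∀ {a b z} ρ → ⟦ â ⟧ ρ ≡ a → ⟦ v₀ ⟧ ρ ≡ b → ⟦ ẑ ⟧ ρ ≡ z →
    CubeSquareCombination (A7 a b) (B7 a b) (z * M a b)
  certified-combination â ẑ (α , β) same ρ refl refl refl = ⟦ F ⟧ ρ , ⟦ G ⟧ ρ , (begin
    ⟦ ẑ ⟧ ρ * M (⟦ â ⟧ ρ) (⟦ v₀ ⟧ ρ)   ≡⟨ cong (⟦ ẑ ⟧ ρ *_) (⟦Mₑ⟧ â v₀ ρ) ⟨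
    ⟦ ẑ ⟧ ρ * ⟦ Mₑ â v₀ ⟧ ρ            ≡⟨ ⟦⊗⟧ ρ ẑ (Mₑ â v₀) ⟨
    ⟦ ẑ ⊗ Mₑ â v₀ ⟧ ρ                 ≡⟨ ≡-by-normalisation (ẑ ⊗ Mₑ â v₀) (F ⊗ A ⊛ 3 ⊕ G ⊗ B ⊛ 2) same ρ ⟩
    ⟦ F ⊗ A ⊛ 3 ⊕ G ⊗ B ⊛ 2 ⟧ ρ       ≡⟨ ⟦⊕⟧ ρ (F ⊗ A ⊛ 3) (G ⊗ B ⊛ 2) ⟩
    ⟦ F ⊗ A ⊛ 3 ⟧ ρ + ⟦ G ⊗ B ⊛ 2 ⟧ ρ ≡⟨ cong₂ _+_ (⟦⊗⊛⟧ F A 3) (⟦⊗⊛⟧ G B 2) ⟩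
    ⟦ F ⟧ ρ * ⟦ A ⟧ ρ ^ 3 + ⟦ G ⟧ ρ * ⟦ B ⟧ ρ ^ 2
      ≡⟨ cong₂ (λ A′ B′ → ⟦ F ⟧ ρ * A′ ^ 3 + ⟦ G ⟧ ρ * B′ ^ 2) {⟦ A ⟧ ρ} {A7 (⟦ â ⟧ ρ) (⟦ v₀ ⟧ ρ)}
               {⟦ B ⟧ ρ} {B7 (⟦ â ⟧ ρ) (⟦ v₀ ⟧ ρ)} (⟦A7ₑ⟧ â v₀ ρ) (⟦B7ₑ⟧ â v₀ ρ) ⟩
    ⟦ F ⟧ ρ * A7 (⟦ â ⟧ ρ) (⟦ v₀ ⟧ ρ) ^ 3 + ⟦ G ⟧ ρ * B7 (⟦ â ⟧ ρ) (⟦ v₀ ⟧ ρ) ^ 2 ∎)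
    where
    open ≡-Reasoning
    F G A B : Expr 2
    F = binaryForm α v₀ v₁
    G = binaryForm β v₀ v₁
    A = A7ₑ â v₀
    B = B7ₑ â v₀
    ⟦⊗⊛⟧ : ∀ e f k → ⟦ e ⊗ f ⊛ k ⟧ ρ ≡ ⟦ e ⟧ ρ * ⟦ f ⟧ ρ ^ k
    ⟦⊗⊛⟧ e f k = trans (⟦⊗⟧ ρ e (f ⊛ k)) (cong (⟦ e ⟧ ρ *_) (⟦⊛⟧ ρ f k))

  -- Pairs (α, β) of binary forms of degree 7 in (b, w) with  z·M(a, b) = α·A₇(a, b)³ + β·B₇(a, b)²
  -- for the cofactors z used below (w¹⁵ or 7ʲ·b¹⁵, where w is a, s or c).  They were found by
  -- solving a linear system over ℚ; only the identities themselves are checked here.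
  module Certificates where
    open import Agda.Builtin.FromNat
    open import Agda.Builtin.FromNeg
    open import Data.Unit.Base using (⊤; tt)
    import Data.Integer.Literals as Literals

    instance
      _ : Number ℤ
      _ = Literals.number
      _ : Negative ℤ
      _ = Literals.negative
      _ : ⊤
      _ = tt

    case₁-a case₁-b case₂-s case₂-b case₃-b case₃-c : List ℤ × List ℤ
    case₁-a =
      (-11386201160778276840588 ∷ 2168051797724074672536 ∷ -3975963003148218819408 ∷ 550539138386341567260 ∷
       -346256993327662760112 ∷ 30888289624052422296 ∷ -664332818729941536 ∷ -2943429455129212 ∷ []) ,
      (-50831255182045878752625 ∷ 40661662969848535646850 ∷ -15682274289192594712860 ∷ 6372482911839397620477 ∷
       -1957704521433453743076 ∷ 241033326025641065154 ∷ -2934415373369266584 ∷ 11775026864720763 ∷ [])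
    case₁-b =
      (167422454189620 ∷ -511195023284596 ∷ 128210097549352 ∷ -55388158662648 ∷
       4608816644460 ∷ -96555017244 ∷ -407718024 ∷ -393992 ∷ []) ,
      (2874329226943839 ∷ -2332566694732239 ∷ 1180663557453198 ∷ -324595721136330 ∷
       35567344550745 ∷ -431904227517 ∷ 1843426026 ∷ -2659446 ∷ [])
    case₂-s =
      (-387556041628 ∷ 1550224166512 ∷ -2546796844984 ∷ 2151331496384 ∷
       -954766341620 ∷ 198862575296 ∷ -13235983096 ∷ -461184080 ∷ []) ,
      (-2616003280989 ∷ 10464013123956 ∷ -17190878703642 ∷ 14521487600592 ∷
       -6444672805935 ∷ 1342322383248 ∷ -89342885898 ∷ 2376039204 ∷ [])
    case₂-b =
      (354164902448 ∷ -1064428184624 ∷ 1234065941584 ∷ -667589348776 ∷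
       157006109680 ∷ -11405182572 ∷ -388412416 ∷ -2757944 ∷ []) ,
      (2390725112580 ∷ -7184442161988 ∷ 8331001304220 ∷ -4504326032430 ∷
       1062670148820 ∷ -73152098649 ∷ 1973738880 ∷ -18616122 ∷ [])
    case₃-b =
      (147507248 ∷ -3103289168 ∷ 25185019216 ∷ -95369906968 ∷
       157006109680 ∷ -79836278004 ∷ -19032208384 ∷ -945974792 ∷ []) ,
      (995720580 ∷ -20945895516 ∷ 170020434780 ∷ -643475147490 ∷
       1062670148820 ∷ -512064690543 ∷ 96713205120 ∷ -6385329846 ∷ [])
    case₃-c =
      (-4 ∷ 112 ∷ -1288 ∷ 7616 ∷
       -23660 ∷ 34496 ∷ -16072 ∷ -3920 ∷ []) ,
      (-27 ∷ 756 ∷ -8694 ∷ 51408 ∷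
       -159705 ∷ 232848 ∷ -108486 ∷ 20196 ∷ [])

  open Certificates

  opaque
    unfolding ⟦_⟧

    d⁶∣M[7∤a] : ∀ {a b d} → Coprime a b → ¬ (+ 7 ∣ a) → d ^ 2 ∣ A7 a b → d ^ 3 ∣ B7 a b → d ^ 6 ∣ M a b
    d⁶∣M[7∤a] {a} {b} {d} a⊥b 7∤a =
      cofactor-divisible {d} {A7 a b} {B7 a b} {a} {b} {M a b} {7} 15 10 prime[7] a⊥b 7∤a
        (certified-combination v₁ (v₁ ⊛ 15) case₁-a _ {a} {b} {a ^ 15} (b ∷ a ∷ []) refl refl refl)
        (certified-combination v₁ (con ((+ 7) ^ 10) ⊗ v₀ ⊛ 15) case₁-b _
                               {a} {b} {(+ 7) ^ 10 * b ^ 15} (b ∷ a ∷ []) refl refl refl)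

    d⁶∣M[a≡7s-7b] : ∀ {a b s d} → a ≡ + 7 * s - + 7 * b → Coprime a b → ¬ (+ 7 ∣ s) →
                    d ^ 2 ∣ A7 a b → d ^ 3 ∣ B7 a b → d ^ 6 ∣ M a b
    d⁶∣M[a≡7s-7b] {a} {b} {s} {d} refl a⊥b 7∤s =
      cofactor-divisible {d} {A7 a b} {B7 a b} {s} {b} {M a b} {7} 15 4 prime[7]
        (coprime-linear {s} {b} (+ 7) (+ 7) a⊥b) 7∤s
        (certified-combination â (v₁ ⊛ 15) case₂-s _ {a} {b} {s ^ 15} (b ∷ s ∷ []) refl refl refl)
        (certified-combination â (con ((+ 7) ^ 4) ⊗ v₀ ⊛ 15) case₂-b _
                               {a} {b} {(+ 7) ^ 4 * b ^ 15} (b ∷ s ∷ []) refl refl refl)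
      where
      â : Expr 2
      â = con (+ 7) ⊗ v₁ ⊖ con (+ 7) ⊗ v₀

    d⁶∣M[a≡49c-7b] : ∀ {a b c d} → a ≡ + 49 * c - + 7 * b → Coprime a b → + 7 ∣ a →
                     d ^ 2 ∣ A7 a b → d ^ 3 ∣ B7 a b → d ^ 6 ∣ M a b
    d⁶∣M[a≡49c-7b] {a} {b} {c} {d} refl a⊥b 7∣a =
      cofactor-divisible {d} {A7 a b} {B7 a b} {b} {c} {M a b} {7} 15 2 prime[7]
        (ℕ.sym (coprime-linear {c} {b} (+ 49) (+ 7) a⊥b)) (λ 7∣b → contradiction (a⊥b (7∣a , 7∣b)) λ ())
        (certified-combination â (v₀ ⊛ 15) case₃-b _ {a} {b} {b ^ 15} (b ∷ c ∷ []) refl refl refl)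
        (certified-combination â (con ((+ 7) ^ 2) ⊗ v₁ ⊛ 15) case₃-c _
                               {a} {b} {(+ 7) ^ 2 * c ^ 15} (b ∷ c ∷ []) refl refl refl)
      where
      â : Expr 2
      â = con (+ 49) ⊗ v₁ ⊖ con (+ 7) ⊗ v₀

  7q≡7[q+b]-7b : ∀ q b → q * + 7 ≡ + 7 * (q + b) - + 7 * b
  7q≡7[q+b]-7b = solve 2 (λ q b → q :* con (+ 7) := con (+ 7) :* (q :+ b) :- con (+ 7) :* b) refl
    where open ℤSolver using (solve; _:=_; _:+_; _:-_; _:*_; con)

  7[7c]-7b≡49c-7b : ∀ c b → + 7 * (c * + 7) - + 7 * b ≡ + 49 * c - + 7 * b
  7[7c]-7b≡49c-7b = solve 2 (λ c b → con (+ 7) :* (c :* con (+ 7)) :- con (+ 7) :* b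
                                    := con (+ 49) :* c :- con (+ 7) :* b) refl
    where open ℤSolver using (solve; _:=_; _:-_; _:*_; con)

  d⁶∣M : ∀ {a b d} → Coprime a b → d ^ 2 ∣ A7 a b → d ^ 3 ∣ B7 a b → d ^ 6 ∣ M a b
  d⁶∣M {a} {b} {d} a⊥b = by-7∣a (7 ℕ.∣? ∣ a ∣)
    where
    Goal : Set
    Goal = d ^ 2 ∣ A7 a b → d ^ 3 ∣ B7 a b → d ^ 6 ∣ M a b

    by-7∣s : ∀ {s} → a ≡ + 7 * s - + 7 * b → + 7 ∣ a → Dec (+ 7 ∣ s) → Goal
    by-7∣s {s} a≡7s-7b 7∣a (no 7∤s)  = d⁶∣M[a≡7s-7b] {a} {b} {s} {d} a≡7s-7b a⊥b 7∤s
    by-7∣s {s} a≡7s-7b 7∣a (yes 7∣s) = d⁶∣M[a≡49c-7b] {a} {b} {c} {d} a≡49c-7b a⊥b 7∣a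
      where
      open Signed._∣_ (Signed.∣ᵤ⇒∣ {+ 7} {s} 7∣s) renaming (quotient to c)
      a≡49c-7b : a ≡ + 49 * c - + 7 * b
      a≡49c-7b = trans a≡7s-7b (trans (cong (λ s → + 7 * s - + 7 * b) equality) (7[7c]-7b≡49c-7b c b))

    by-7∣a : Dec (+ 7 ∣ a) → Goal
    by-7∣a (no 7∤a)  = d⁶∣M[7∤a] {a} {b} {d} a⊥b 7∤a
    by-7∣a (yes 7∣a) = by-7∣s {q + b} (trans equality (7q≡7[q+b]-7b q b)) 7∣a (7 ℕ.∣? ∣ q + b ∣)
      where open Signed._∣_ (Signed.∣ᵤ⇒∣ {+ 7} {a} 7∣a) renaming (quotient to q)

  e⁶≤∣U∣²κ : ∀ {a b e} → gcd a b ≡ + 1 → 0ℤ < b → (+ e) ^ 2 ∣ A7 a b → (+ e) ^ 3 ∣ B7 a b →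
             e ℕ.^ 6 ℕ.≤ ∣ U a b ∣ ℕ.* ∣ U a b ∣ ℕ.* κ
  e⁶≤∣U∣²κ {a} {b} {e} gcd≡1 0<b e²∣A e³∣B = ℕ.∣⇒≤ (subst₂ ℕ._∣_ (∣i^n∣≡∣i∣^n (+ e) 6) ∣M∣ e⁶∣M)
    where
    instance
      _ : ℕ.NonZero ∣ U a b ∣
      _ = >-nonZero (0<U a 0<b)
      _ : ℕ.NonZero (∣ U a b ∣ ℕ.* ∣ U a b ∣)
      _ = ℕₚ.m*n≢0 ∣ U a b ∣ ∣ U a b ∣
      _ : ℕ.NonZero (∣ U a b ∣ ℕ.* ∣ U a b ∣ ℕ.* κ)
      _ = ℕₚ.m*n≢0 (∣ U a b ∣ ℕ.* ∣ U a b ∣) κ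
    e⁶∣M : (+ e) ^ 6 ∣ M a b
    e⁶∣M = d⁶∣M {a} {b} {+ e} (ℕ.gcd≡1⇒coprime (ℤₚ.+-injective gcd≡1)) e²∣A e³∣B
    ∣M∣ : ∣ M a b ∣ ≡ ∣ U a b ∣ ℕ.* ∣ U a b ∣ ℕ.* κ
    ∣M∣ = trans (ℤₚ.abs-* (U a b * U a b) (+ κ)) (cong (ℕ._* κ) (ℤₚ.abs-* (U a b) (U a b)))

  -- The height of (A₇, B₇)

  -- On each region the gap is a binary form with non-negative coefficients in two quantities
  -- that are non-negative there.
  opaque
    unfolding ⟦_⟧

    U≤Q₂ : ∀ {a b} → 0ℤ ≤ b → a ≤ + 3 * b → U a b ≤ Q₂ a b
    U≤Q₂ {a} {b} 0≤b a≤3b = ≤-by-nonNeg-gap (Q₂ₑ v₀ v₁) (Uₑ v₀ v₁) v₁ (con (+ 3) ⊗ v₁ ⊖ v₀)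
      (32 ∷ 232 ∷ 0 ∷ []) _ (a ∷ b ∷ []) 0≤b (ℤₚ.i≤j⇒0≤j-i a≤3b)

    U²≤-Q₄ : ∀ {a b} → + 3 * b ≤ a → a ≤ + 4 * b → U a b * U a b ≤ - Q₄ a b
    U²≤-Q₄ {a} {b} 3b≤a a≤4b = ≤-by-nonNeg-gap (⊝ Q₄ₑ v₀ v₁) (Uₑ v₀ v₁ ⊗ Uₑ v₀ v₁)
      (v₀ ⊖ con (+ 3) ⊗ v₁) (con (+ 4) ⊗ v₁ ⊖ v₀) (182394 ∷ 673156 ∷ 929682 ∷ 570024 ∷ 131102 ∷ [])
      _ (a ∷ b ∷ []) (ℤₚ.i≤j⇒0≤j-i 3b≤a) (ℤₚ.i≤j⇒0≤j-i a≤4b)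

    7203U≤2401[-Q₂] : ∀ {a b} → + 4 * b ≤ a → a ≤ + 53 * b → + 7203 * U a b ≤ + 2401 * - Q₂ a b
    7203U≤2401[-Q₂] {a} {b} 4b≤a a≤53b = ≤-by-nonNeg-gap (con (+ 2401) ⊗ ⊝ Q₂ₑ v₀ v₁) (con (+ 7203) ⊗ Uₑ v₀ v₁)
      (v₀ ⊖ con (+ 4) ⊗ v₁) (con (+ 53) ⊗ v₁ ⊖ v₀) (92 ∷ 9788 ∷ 92 ∷ [])
      _ (a ∷ b ∷ []) (ℤₚ.i≤j⇒0≤j-i 4b≤a) (ℤₚ.i≤j⇒0≤j-i a≤53b)

    U²≤Q₄ : ∀ {a b} → 0ℤ ≤ b → + 53 * b ≤ a → U a b * U a b ≤ Q₄ a b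
    U²≤Q₄ {a} {b} 0≤b 53b≤a = ≤-by-nonNeg-gap (Q₄ₑ v₀ v₁) (Uₑ v₀ v₁ ⊗ Uₑ v₀ v₁)
      (v₀ ⊖ con (+ 53) ⊗ v₁) v₁ (0 ∷ 516 ∷ 71004 ∷ 3184252 ∷ 46070776 ∷ [])
      _ (a ∷ b ∷ []) (ℤₚ.i≤j⇒0≤j-i 53b≤a) 0≤b

  ∣U∣≤∣Q₂∣⊎∣U∣²≤∣Q₄∣ : ∀ a {b} → 0ℤ < b → ∣ U a b ∣ ℕ.≤ ∣ Q₂ a b ∣ ⊎ ∣ U a b ∣ ℕ.* ∣ U a b ∣ ℕ.≤ ∣ Q₄ a b ∣
  ∣U∣≤∣Q₂∣⊎∣U∣²≤∣Q₄∣ a {b} 0<b =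
    by-region (ℤₚ.≤-total a (+ 3 * b)) (ℤₚ.≤-total a (+ 4 * b)) (ℤₚ.≤-total a (+ 53 * b))
    where
    0≤b = ℤₚ.<⇒≤ 0<b
    0≤U = ℤₚ.<⇒≤ (0<U a 0<b)
    u = ∣ U a b ∣
    ∣U²∣ : ∣ U a b * U a b ∣ ≡ u ℕ.* u
    ∣U²∣ = ℤₚ.abs-* (U a b) (U a b)

    by-region : a ≤ + 3 * b ⊎ + 3 * b ≤ a → a ≤ + 4 * b ⊎ + 4 * b ≤ a → a ≤ + 53 * b ⊎ + 53 * b ≤ a →
                u ℕ.≤ ∣ Q₂ a b ∣ ⊎ u ℕ.* u ℕ.≤ ∣ Q₄ a b ∣
    by-region (inj₁ a≤3b) _ _ = inj₁ (0≤i≤j⇒∣i∣≤∣j∣ 0≤U (U≤Q₂ 0≤b a≤3b))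
    by-region (inj₂ 3b≤a) (inj₁ a≤4b) _ = inj₂ (subst₂ ℕ._≤_ ∣U²∣ (ℤₚ.∣-i∣≡∣i∣ (Q₄ a b))
      (0≤i≤j⇒∣i∣≤∣j∣ (*-nonNeg 0≤U 0≤U) (U²≤-Q₄ 3b≤a a≤4b)))
    by-region (inj₂ _) (inj₂ 4b≤a) (inj₁ a≤53b) = inj₁ (ℕₚ.*-cancelˡ-≤ 2401 (begin
      2401 ℕ.* u             ≤⟨ ℕₚ.*-monoˡ-≤ u (ℕₚ.≤ᵇ⇒≤ 2401 7203 _) ⟩
      7203 ℕ.* u             ≡⟨ ℤₚ.abs-* (+ 7203) (U a b) ⟨
      ∣ + 7203 * U a b ∣      ≤⟨ 0≤i≤j⇒∣i∣≤∣j∣ (*-nonNeg {+ 7203} (+≤+ z≤n) 0≤U) (7203U≤2401[-Q₂] 4b≤a a≤53b) ⟩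
      ∣ + 2401 * - Q₂ a b ∣   ≡⟨ ℤₚ.abs-* (+ 2401) (- Q₂ a b) ⟩
      2401 ℕ.* ∣ - Q₂ a b ∣   ≡⟨ cong (2401 ℕ.*_) (ℤₚ.∣-i∣≡∣i∣ (Q₂ a b)) ⟩
      2401 ℕ.* ∣ Q₂ a b ∣     ∎))
      where open ℕₚ.≤-Reasoning
    by-region (inj₂ _) (inj₂ _) (inj₂ 53b≤a) = inj₂ (subst (ℕ._≤ ∣ Q₄ a b ∣) ∣U²∣
      (0≤i≤j⇒∣i∣≤∣j∣ (*-nonNeg 0≤U 0≤U) (U²≤Q₄ 0≤b 53b≤a)))

  ∣A7∣≡3∣U∣∣Q₂∣ : ∀ a b → ∣ A7 a b ∣ ≡ 3 ℕ.* ∣ U a b ∣ ℕ.* ∣ Q₂ a b ∣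
  ∣A7∣≡3∣U∣∣Q₂∣ a b = begin
    ∣ A7 a b ∣                       ≡⟨ cong ∣_∣ (A7≡-3UQ₂ a b) ⟩
    ∣ - + 3 * U a b * Q₂ a b ∣       ≡⟨ ℤₚ.abs-* (- + 3 * U a b) (Q₂ a b) ⟩
    ∣ - + 3 * U a b ∣ ℕ.* ∣ Q₂ a b ∣ ≡⟨ cong (ℕ._* ∣ Q₂ a b ∣) (ℤₚ.abs-* (- + 3) (U a b)) ⟩
    3 ℕ.* ∣ U a b ∣ ℕ.* ∣ Q₂ a b ∣   ∎
    where open ≡-Reasoning

  ∣B7∣≡2∣U∣∣Q₄∣ : ∀ a b → ∣ B7 a b ∣ ≡ 2 ℕ.* ∣ U a b ∣ ℕ.* ∣ Q₄ a b ∣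
  ∣B7∣≡2∣U∣∣Q₄∣ a b = begin
    ∣ B7 a b ∣                       ≡⟨ cong ∣_∣ (B7≡2UQ₄ a b) ⟩
    ∣ + 2 * U a b * Q₄ a b ∣         ≡⟨ ℤₚ.abs-* (+ 2 * U a b) (Q₄ a b) ⟩
    ∣ + 2 * U a b ∣ ℕ.* ∣ Q₄ a b ∣   ≡⟨ cong (ℕ._* ∣ Q₄ a b ∣) (ℤₚ.abs-* (+ 2) (U a b)) ⟩
    2 ℕ.* ∣ U a b ∣ ℕ.* ∣ Q₄ a b ∣   ∎
    where open ≡-Reasoning

  108∣U∣⁶≤H : ∀ a {b} → 0ℤ < b → 108 ℕ.* ∣ U a b ∣ ℕ.^ 6 ℕ.≤ H (A7 a b) (B7 a b)
  108∣U∣⁶≤H a {b} 0<b = by-domination (∣U∣≤∣Q₂∣⊎∣U∣²≤∣Q₄∣ a 0<b)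
    where
    u = ∣ U a b ∣
    by-domination : u ℕ.≤ ∣ Q₂ a b ∣ ⊎ u ℕ.* u ℕ.≤ ∣ Q₄ a b ∣ → 108 ℕ.* u ℕ.^ 6 ℕ.≤ H (A7 a b) (B7 a b)
    by-domination (inj₁ u≤q₂) = begin
      108 ℕ.* u ℕ.^ 6                       ≤⟨ u≤q⇒108u⁶≤4[3uq]³ {u} u≤q₂ ⟩
      4 ℕ.* (3 ℕ.* u ℕ.* ∣ Q₂ a b ∣) ℕ.^ 3  ≡⟨ cong (λ x → 4 ℕ.* x ℕ.^ 3) (∣A7∣≡3∣U∣∣Q₂∣ a b) ⟨
      4 ℕ.* ∣ A7 a b ∣ ℕ.^ 3                ≡⟨ ∣+k*i^n∣≡k*∣i∣^n 4 (A7 a b) 3 ⟨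
      ∣ + 4 * A7 a b ^ 3 ∣                  ≤⟨ ℕₚ.m≤m⊔n _ _ ⟩
      H (A7 a b) (B7 a b)                   ∎
      where open ℕₚ.≤-Reasoning
    by-domination (inj₂ u²≤q₄) = begin
      108 ℕ.* u ℕ.^ 6                       ≤⟨ u²≤q⇒108u⁶≤27[2uq]² {u} u²≤q₄ ⟩
      27 ℕ.* (2 ℕ.* u ℕ.* ∣ Q₄ a b ∣) ℕ.^ 2 ≡⟨ cong (λ x → 27 ℕ.* x ℕ.^ 2) (∣B7∣≡2∣U∣∣Q₄∣ a b) ⟨
      27 ℕ.* ∣ B7 a b ∣ ℕ.^ 2               ≡⟨ ∣+k*i^n∣≡k*∣i∣^n 27 (B7 a b) 2 ⟨
      ∣ + 27 * B7 a b ^ 2 ∣                 ≤⟨ ℕₚ.m≤n⊔m _ _ ⟩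
      H (A7 a b) (B7 a b)                   ∎
      where open ℕₚ.≤-Reasoning

  4κ³≤3¹⁵7⁵⁴108 : 4 ℕ.* κ ℕ.^ 3 ℕ.≤ 3 ℕ.^ 15 ℕ.* 7 ℕ.^ 54 ℕ.* 108
  4κ³≤3¹⁵7⁵⁴108 = ℕₚ.≤ᵇ⇒≤ (4 ℕ.* κ ℕ.^ 3) (3 ℕ.^ 15 ℕ.* 7 ℕ.^ 54 ℕ.* 108) _

  e¹²*4e⁶≤3¹⁵7⁵⁴H : ∀ {a b e} → Groomed7 a b → IsTmdCandidate (A7 a b) (B7 a b) e →
                    e ℕ.^ 12 ℕ.* (4 ℕ.* e ℕ.^ 6) ℕ.≤ 3 ℕ.^ 15 ℕ.* 7 ℕ.^ 54 ℕ.* H (A7 a b) (B7 a b)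
  e¹²*4e⁶≤3¹⁵7⁵⁴H {a} {b} {e} (gcd≡1 , 0<b , _) (_ , e²∣A , e³∣B) =
    subst (ℕ._≤ 3 ℕ.^ 15 ℕ.* 7 ℕ.^ 54 ℕ.* H (A7 a b) (B7 a b)) (sym (e¹²*4e⁶≡4[e⁶]³ e))
      (x≤u²k⇒4x³≤ch {e ℕ.^ 6} {∣ U a b ∣} {κ} {3 ℕ.^ 15 ℕ.* 7 ℕ.^ 54} {H (A7 a b) (B7 a b)}
        (e⁶≤∣U∣²κ {a} {b} {e} gcd≡1 0<b e²∣A e³∣B) 4κ³≤3¹⁵7⁵⁴108 (108∣U∣⁶≤H a {b} 0<b))

open import Data.Nat as ℕ using (ℕ; NonZero)
open import Data.Integer using (ℤ; +_)
open import Data.Rational as ℚ using (ℚ; _/_; _≤_; _*_)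
open import Data.Nat.Properties using (m^n≢0)
open import Data.Product.Base using (_,_)

corollary4p2p6 : (a b : ℤ) → Groomed7 a b →
    (e : ℕ) → .{{_ : NonZero e}} → IsTmd (A7 a b) (B7 a b) e →
    (+ (e ℕ.^ 12)) / 1 ≤ ((+ (3 ℕ.^ 15 ℕ.* 7 ℕ.^ 54)) / 4) * twht (A7 a b) (B7 a b) e
corollary4p2p6 a b groomed e (candidate , _) =
  n*[d*m]≤c*h⇒n/1≤c/d*h/m {e ℕ.^ 12} {3 ℕ.^ 15 ℕ.* 7 ℕ.^ 54} {H (A7 a b) (B7 a b)} {4} {e ℕ.^ 6}
    {{_}} {{m^n≢0 e 6}} (e¹²*4e⁶≤3¹⁵7⁵⁴H {a} {b} {e} groomed candidate)
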